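{- Let $F\subseteq E(Q_5)$ and let $M$ be a matching of $Q_5-F$ with $1\leq |M|\leq 8$ and $|F|\leq 4-\lceil |M|/2\rceil$. Then there exists $j\in[5]$ such that $|E_j\cap(M\cup F)|\leq 1$ and, for each $\delta\in\{0,1\}$, the triple $(Q_4^\delta, M_\delta, F_\delta)$ is not exceptional, where $Q_4^\delta$ is the subcube of $Q_5$ induced by the vertices whose $j$-th coordinate is $\delta$, $M_\delta=M\cap E(Q_4^\delta)$ and $F_\delta=F\cap E(Q_4^\delta)$. Here a triple $(Q_4^\delta,M_\delta,F_\delta)$ is called exceptional if $|M_\delta|=4$, $|F_\delta|=1$, and there is a dimension $i\neq j$ such that $M_\delta\cup F_\delta\subseteq E_i$ and the four endpoints of the edges of $M_\delta$ whose $i$-th coordinate is $0$ are pairwise at distance $2$.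
   Context: $Q_5$ is the 5-dimensional hypercube (binary strings of length 5, adjacent iff they differ in one position); $E_i$ is the set of edges whose endpoints differ in coordinate $i$; $Q_5-F$ is $Q_5$ with the edges of $F$ deleted; distance is graph (Hamming) distance. A matching is a set of pairwise vertex-disjoint edges. Deleting $E_j$ splits $Q_5$ into two copies $Q_4^0,Q_4^1$ of $Q_4$. -}

module Defs where

open import Data.Bool using (Bool; true; false; _∨_; _∧_; if_then_else_; not)
open import Data.Nat using (ℕ; zero; suc; _+_; _≤_; ⌈_/2⌉; _∸_)
open import Data.Fin using (Fin)
open import Data.Fin.Properties using () renaming (_≟_ to _≟ᶠ_)
open import Data.Vec using (Vec; []; _∷_; lookup; insertAt)
open import Data.List using (List; []; _∷_; _++_; map; concatMap; allFin)
open import Data.Product using (_×_; _,_; proj₁; proj₂; Σ; ∃-syntax)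
open import Relation.Binary.PropositionalEquality using (_≡_; _≢_)
open import Relation.Nullary using (¬_; does)

Vertex : Set
Vertex = Vec Bool 5

-- An edge of Q_5 is given by its direction i (the coordinate in which its
-- endpoints differ) and the 4 remaining coordinates.  This is a bijection
-- with E(Q_5) (5 * 2^4 = 80 edges).
Edge : Set
Edge = Fin 5 × Vec Bool 4

dir : Edge → Fin 5
dir = proj₁

lo hi : Edge → Vertex
lo (i , r) = insertAt r i false
hi (i , r) = insertAt r i true

allVecs : (n : ℕ) → List (Vec Bool n)
allVecs zero = [] ∷ []
allVecs (suc n) = map (false ∷_) (allVecs n) ++ map (true ∷_) (allVecs n)

allEdges : List Edge
allEdges = concatMap (λ i → map (i ,_) (allVecs 4)) (allFin 5)

EdgeSet : Set
EdgeSet = Edge → Bool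

_∈ₑ_ : Edge → EdgeSet → Set
e ∈ₑ S = S e ≡ true

_∪ₑ_ _∩ₑ_ : EdgeSet → EdgeSet → EdgeSet
(S ∪ₑ T) e = S e ∨ T e
(S ∩ₑ T) e = S e ∧ T e

countList : List Edge → EdgeSet → ℕ
countList [] S = 0
countList (e ∷ es) S = (if S e then 1 else 0) + countList es S

∣_∣ₑ : EdgeSet → ℕ
∣ S ∣ₑ = countList allEdges S

Edir : Fin 5 → EdgeSet
Edir j e = does (dir e ≟ᶠ j)

-- E(Q_4^δ) for the split along coordinate j: edges not in E_j whose
-- endpoints have j-th coordinate δ
Esub : Fin 5 → Bool → EdgeSet
Esub j δ e = not (does (dir e ≟ᶠ j)) ∧ (if lookup (lo e) j then δ else not δ)

hamming : ∀ {n} → Vec Bool n → Vec Bool n → ℕ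
hamming [] [] = 0
hamming (x ∷ xs) (y ∷ ys) = (if x then (if y then 0 else 1) else (if y then 1 else 0)) + hamming xs ys

VertexDisjoint : Edge → Edge → Set
VertexDisjoint e e' = lo e ≢ lo e' × lo e ≢ hi e' × hi e ≢ lo e' × hi e ≢ hi e'

IsMatchingOf : EdgeSet → EdgeSet → Set
IsMatchingOf M F =
  (∀ e → e ∈ₑ M → F e ≡ false) ×
  (∀ e e' → e ∈ₑ M → e' ∈ₑ M → e ≢ e' → VertexDisjoint e e')

Exceptional : Fin 5 → Bool → EdgeSet → EdgeSet → Set
Exceptional j δ M F =
  let Mδ = M ∩ₑ Esub j δ
      Fδ = F ∩ₑ Esub j δ
  in ∣ Mδ ∣ₑ ≡ 4 × ∣ Fδ ∣ₑ ≡ 1 ×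
     ∃[ i ] (i ≢ j ×
       (∀ e → e ∈ₑ (Mδ ∪ₑ Fδ) → e ∈ₑ Edir i) ×
       -- the endpoints of M_δ-edges with i-th coordinate 0 (= lo e, as dir e = i)
       -- are pairwise at distance 2
       (∀ e e' → e ∈ₑ Mδ → e' ∈ₑ Mδ → e ≢ e' → hamming (lo e) (lo e') ≡ 2))

-- Call a direction j light if at most one edge of M ∪ F lies in E_j. The
-- loads ∣E_j ∩ (M ∪ F)∣ sum to ∣M ∪ F∣ ≤ 8, so some direction is light.
-- Suppose every light direction j had an exceptional side. Its M_δ and F_δ are
-- five edges of one direction i, so ∣F∣ ≥ 1 and the budget gives ∣M∣ + ∣F∣ ≤ 7:
-- then i is the only direction of load ≥ 5, hence the dimension of the
-- exceptional triple of every light j, and the other four directions carry at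
-- most two edges, so two of them are light.
-- Each light j yields four M-edges of direction i whose lower endpoints agree in
-- coordinate j and are pairwise at distance 2. Two such quadruples for
-- different j share at most two edges, as shared edges agreeing in one further
-- coordinate would be at distance ≤ 1. So direction i carries six M-edges and
-- an F-edge, its load 7 makes all four other directions light, and their four
-- quadruples are 4-subsets of the at most six M-edges of direction i meeting
-- pairwise in at most two edges: every edge is missed by at most one of them,
-- yet each misses two, so 8 ≤ 6.

module Submission where

open import Defs
open import Data.Bool using (Bool; true; false; _∨_; _∧_; not; if_then_else_)
import Data.Bool.Properties as Bool
open import Data.Empty using (⊥; ⊥-elim)
open import Data.Fin using (Fin; zero; suc; punchIn; punchOut)
import Data.Fin.Properties as Fin
open import Data.List using ([]; _∷_; map)
open import Data.List.Membership.Propositional using (_∈_)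
open import Data.List.Membership.Propositional.Properties
  using (∈-map⁺; ∈-++⁺ˡ; ∈-++⁺ʳ; ∈-concatMap⁺; ∈-allFin)
open import Data.List.Relation.Unary.All as All using (All; []; _∷_)
open import Data.List.Relation.Unary.AllPairs using (_∷_; allPairs?)
open import Data.List.Relation.Unary.Any as Any using (here; there)
open import Data.List.Relation.Unary.Unique.Propositional using (Unique)
open import Data.Nat
  using (ℕ; zero; suc; _+_; _*_; _∸_; _≤_; _<_; _≤?_; _<?_; z≤n; s≤s; s≤s⁻¹; z<s; s<s; ⌈_/2⌉; ⌊_/2⌋)
open import Data.Nat.Properties
open import Data.Product using (_×_; _,_; proj₁; proj₂; ∃₂; ∃-syntax)
open import Data.Product.Properties using (≡-dec)
open import Data.Sum using (_⊎_; inj₁; inj₂; [_,_]′)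
open import Data.Vec using (Vec; []; _∷_; lookup)
open import Data.Vec.Functional using (removeAt)
import Data.Vec.Properties as Vec
open import Function using (_∘_)
open import Relation.Binary using (DecidableEquality)
open import Relation.Binary.PropositionalEquality
open import Relation.Nullary using (¬_; Dec; yes; no; ¬?)
open import Relation.Nullary.Decidable
  using (_×-dec_; _⊎-dec_; _→-dec_; map′; toWitness; decidable-stable)

open import Algebra.Properties.CommutativeMonoid.Sum +-0-commutativeMonoid
  using (sum; sum-remove; ∑-distrib-+)

open import Algebra.Properties.CommutativeSemigroup +-commutativeSemigroup
  using () renaming (interchange to +-interchange)

-- Counting edge sets

_≟ₑ_ : DecidableEquality Edge
_≟ₑ_ = ≡-dec Fin._≟_ (Vec.≡-dec Bool._≟_)

∈-allVecs : ∀ {n} (v : Vec Bool n) → v ∈ allVecs n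
∈-allVecs [] = here refl
∈-allVecs (false ∷ v) = ∈-++⁺ˡ (∈-map⁺ (false ∷_) (∈-allVecs v))
∈-allVecs {suc n} (true ∷ v) = ∈-++⁺ʳ (map (false ∷_) (allVecs n)) (∈-map⁺ (true ∷_) (∈-allVecs v))

∈-allEdges : ∀ e → e ∈ allEdges
∈-allEdges (i , r) = ∈-concatMap⁺ (λ i → map (i ,_) (allVecs 4))
  (Any.map (λ { refl → ∈-map⁺ (i ,_) (∈-allVecs r) }) (∈-allFin i))

allEdges-unique : Unique allEdges
allEdges-unique = toWitness {a? = allPairs? (λ e e' → ¬? (e ≟ₑ e')) allEdges} _

∀-edges? : {P : Edge → Set} → (∀ e → Dec (P e)) → Dec (∀ e → P e)
∀-edges? P? = map′ (λ all e → All.lookup all (∈-allEdges e)) (λ ∀P → All.tabulate (λ {e} _ → ∀P e))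
  (All.all? P? allEdges)

infix 4 _⊆ₑ_

_⊆ₑ_ : EdgeSet → EdgeSet → Set
S ⊆ₑ T = ∀ e → e ∈ₑ S → e ∈ₑ T

_∖ₑ_ : EdgeSet → EdgeSet → EdgeSet
(S ∖ₑ T) e = S e ∧ not (T e)

bit : Bool → ℕ
bit b = if b then 1 else 0

module _ {e : Edge} {S T : EdgeSet} where

  ∩⁻ˡ : e ∈ₑ (S ∩ₑ T) → e ∈ₑ S
  ∩⁻ˡ = Bool.∧-conicalˡ (S e) (T e)

  ∩⁻ʳ : e ∈ₑ (S ∩ₑ T) → e ∈ₑ T
  ∩⁻ʳ = Bool.∧-conicalʳ (S e) (T e)

  ∩⁺ : e ∈ₑ S → e ∈ₑ T → e ∈ₑ (S ∩ₑ T)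
  ∩⁺ e∈S e∈T rewrite e∈S | e∈T = refl

  ∪⁺ˡ : e ∈ₑ S → e ∈ₑ (S ∪ₑ T)
  ∪⁺ˡ e∈S rewrite e∈S = refl

  ∪⁺ʳ : e ∈ₑ T → e ∈ₑ (S ∪ₑ T)
  ∪⁺ʳ e∈T rewrite e∈T = Bool.∨-zeroʳ (S e)

  ∪⁻ : e ∈ₑ (S ∪ₑ T) → e ∈ₑ S ⊎ e ∈ₑ T
  ∪⁻ e∈ with S e
  ... | true = inj₁ refl
  ... | false = inj₂ e∈

  ∖⁻ˡ : e ∈ₑ (S ∖ₑ T) → e ∈ₑ S
  ∖⁻ˡ = Bool.∧-conicalˡ (S e) (not (T e))

  ∖⁻ʳ : e ∈ₑ (S ∖ₑ T) → T e ≡ false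
  ∖⁻ʳ e∈ = Bool.not-injective (Bool.∧-conicalʳ (S e) (not (T e)) e∈)

  ∖⁺ : e ∈ₑ S → ¬ e ∈ₑ T → e ∈ₑ (S ∖ₑ T)
  ∖⁺ e∈S e∉T rewrite e∈S | Bool.¬-not e∉T = refl

∪-⊆ : ∀ {S T U} → S ⊆ₑ U → T ⊆ₑ U → (S ∪ₑ T) ⊆ₑ U
∪-⊆ {S} {T} S⊆U T⊆U e e∈ with ∪⁻ {S = S} {T} e∈
... | inj₁ e∈S = S⊆U e e∈S
... | inj₂ e∈T = T⊆U e e∈T

countList-cong : ∀ xs {S T} → (∀ e → S e ≡ T e) → countList xs S ≡ countList xs T
countList-cong [] _ = refl
countList-cong (e ∷ xs) S≗T = cong₂ _+_ (cong bit (S≗T e)) (countList-cong xs S≗T)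

countList-mono : ∀ xs {S T} → S ⊆ₑ T → countList xs S ≤ countList xs T
countList-mono [] _ = z≤n
countList-mono (e ∷ xs) {S} S⊆T = +-mono-≤ (bit-mono (S e) (S⊆T e)) (countList-mono xs S⊆T)
  where
  bit-mono : ∀ a {b} → (a ≡ true → b ≡ true) → bit a ≤ bit b
  bit-mono false _ = z≤n
  bit-mono true a⇒b rewrite a⇒b refl = ≤-refl

countList-∪-∩ : ∀ xs S T → countList xs (S ∪ₑ T) + countList xs (S ∩ₑ T) ≡ countList xs S + countList xs T
countList-∪-∩ [] S T = refl
countList-∪-∩ (e ∷ xs) S T = begin
  bit (S e ∨ T e) + ∣∪∣ + (bit (S e ∧ T e) + ∣∩∣)
    ≡⟨ +-interchange (bit (S e ∨ T e)) ∣∪∣ (bit (S e ∧ T e)) ∣∩∣ ⟩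
  bit (S e ∨ T e) + bit (S e ∧ T e) + (∣∪∣ + ∣∩∣)
    ≡⟨ cong₂ _+_ (bit-∪-∩ (S e) (T e)) (countList-∪-∩ xs S T) ⟩
  bit (S e) + bit (T e) + (∣S∣ + ∣T∣)
    ≡⟨ +-interchange (bit (S e)) (bit (T e)) ∣S∣ ∣T∣ ⟩
  bit (S e) + ∣S∣ + (bit (T e) + ∣T∣) ∎
  where
  open ≡-Reasoning
  ∣∪∣ = countList xs (S ∪ₑ T)
  ∣∩∣ = countList xs (S ∩ₑ T)
  ∣S∣ = countList xs S
  ∣T∣ = countList xs T
  bit-∪-∩ : ∀ a b → bit (a ∨ b) + bit (a ∧ b) ≡ bit a + bit b
  bit-∪-∩ false false = refl
  bit-∪-∩ false true = refl
  bit-∪-∩ true false = refl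
  bit-∪-∩ true true = refl

countList-∩-∖ : ∀ xs S T → countList xs (S ∩ₑ T) + countList xs (S ∖ₑ T) ≡ countList xs S
countList-∩-∖ [] S T = refl
countList-∩-∖ (e ∷ xs) S T =
  trans (+-interchange (bit (S e ∧ T e)) (countList xs (S ∩ₑ T)) (bit (S e ∧ not (T e))) (countList xs (S ∖ₑ T)))
        (cong₂ _+_ (bit-∩-∖ (S e) (T e)) (countList-∩-∖ xs S T))
  where
  bit-∩-∖ : ∀ a b → bit (a ∧ b) + bit (a ∧ not b) ≡ bit a
  bit-∩-∖ false b = refl
  bit-∩-∖ true false = refl
  bit-∩-∖ true true = refl

∈⇒1≤countList : ∀ {xs S e} → e ∈ xs → e ∈ₑ S → 1 ≤ countList xs S
∈⇒1≤countList {e ∷ xs} (here refl) e∈S rewrite e∈S = s≤s z≤n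
∈⇒1≤countList {e' ∷ xs} {S} (there e∈xs) e∈S = ≤-trans (∈⇒1≤countList e∈xs e∈S) (m≤n+m _ (bit (S e')))

countList-none : ∀ xs {S} → All (λ e → ¬ e ∈ₑ S) xs → countList xs S ≡ 0
countList-none [] _ = refl
countList-none (e ∷ xs) (e∉S ∷ rest) rewrite Bool.¬-not e∉S = countList-none xs rest

countList-≤1 : ∀ {xs S} → Unique xs → (∀ e e' → e ∈ₑ S → e' ∈ₑ S → e ≡ e') → countList xs S ≤ 1
countList-≤1 {[]} _ _ = z≤n
countList-≤1 {e ∷ xs} {S} (e∉xs ∷ unique) S-single with S e in e∈S
... | false = countList-≤1 unique S-single
... | true = s≤s (≤-reflexive (countList-none xs (All.map (λ e≢e' e'∈S → e≢e' (S-single _ _ e∈S e'∈S)) e∉xs)))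

countList-by-direction : ∀ xs S → countList xs S ≡ sum (λ j → countList xs (Edir j ∩ₑ S))
countList-by-direction [] S = refl
countList-by-direction (e ∷ xs) S = begin
  bit (S e) + countList xs S
    ≡⟨ cong₂ _+_ (bit-by-direction e (S e)) (countList-by-direction xs S) ⟩
  sum (λ j → bit (Edir j e ∧ S e)) + sum (λ j → countList xs (Edir j ∩ₑ S))
    ≡⟨ ∑-distrib-+ (λ j → bit (Edir j e ∧ S e)) (λ j → countList xs (Edir j ∩ₑ S)) ⟨
  sum (λ j → countList (e ∷ xs) (Edir j ∩ₑ S)) ∎
  where
  open ≡-Reasoning
  bit-by-direction : ∀ e b → bit b ≡ sum (λ j → bit (Edir j e ∧ b))
  bit-by-direction (zero , _) b = sym (+-identityʳ (bit b))
  bit-by-direction (suc zero , _) b = sym (+-identityʳ (bit b))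
  bit-by-direction (suc (suc zero) , _) b = sym (+-identityʳ (bit b))
  bit-by-direction (suc (suc (suc zero)) , _) b = sym (+-identityʳ (bit b))
  bit-by-direction (suc (suc (suc (suc zero))) , _) b = sym (+-identityʳ (bit b))

∣∣-mono : ∀ {S T} → S ⊆ₑ T → ∣ S ∣ₑ ≤ ∣ T ∣ₑ
∣∣-mono {S} {T} = countList-mono allEdges {S} {T}

∈ₑ⇒1≤∣∣ : ∀ {S e} → e ∈ₑ S → 1 ≤ ∣ S ∣ₑ
∈ₑ⇒1≤∣∣ {S} {e} = ∈⇒1≤countList {allEdges} {S} (∈-allEdges e)

∣∪∣≤ : ∀ S T → ∣ S ∪ₑ T ∣ₑ ≤ ∣ S ∣ₑ + ∣ T ∣ₑ
∣∪∣≤ S T = ≤-trans (m≤m+n _ _) (≤-reflexive (countList-∪-∩ allEdges S T))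

∣∪∣-disjoint : ∀ {S T} → (∀ e → e ∈ₑ S → ¬ e ∈ₑ T) → ∣ S ∪ₑ T ∣ₑ ≡ ∣ S ∣ₑ + ∣ T ∣ₑ
∣∪∣-disjoint {S} {T} disjoint = begin
  ∣ S ∪ₑ T ∣ₑ               ≡⟨ +-identityʳ _ ⟨
  ∣ S ∪ₑ T ∣ₑ + 0           ≡⟨ cong (∣ S ∪ₑ T ∣ₑ +_) ∣S∩T∣≡0 ⟨
  ∣ S ∪ₑ T ∣ₑ + ∣ S ∩ₑ T ∣ₑ ≡⟨ countList-∪-∩ allEdges S T ⟩
  ∣ S ∣ₑ + ∣ T ∣ₑ           ∎
  where
  open ≡-Reasoning
  ∣S∩T∣≡0 : ∣ S ∩ₑ T ∣ₑ ≡ 0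
  ∣S∩T∣≡0 = countList-none allEdges {S ∩ₑ T} (All.tabulate λ {e} _ e∈S∩T →
    disjoint e (∩⁻ˡ {S = S} {T} e∈S∩T) (∩⁻ʳ {S = S} {T} e∈S∩T))

∣T∣+∣S∖T∣≡∣S∣ : ∀ {S T} → T ⊆ₑ S → ∣ T ∣ₑ + ∣ S ∖ₑ T ∣ₑ ≡ ∣ S ∣ₑ
∣T∣+∣S∖T∣≡∣S∣ {S} {T} T⊆S =
  trans (cong (_+ ∣ S ∖ₑ T ∣ₑ) (countList-cong allEdges S∩T≗T)) (countList-∩-∖ allEdges S T)
  where
  S∩T≗T : ∀ e → T e ≡ (S ∩ₑ T) e
  S∩T≗T e with T e in e∈T
  ... | true rewrite T⊆S e e∈T = refl
  ... | false = sym (Bool.∧-zeroʳ (S e))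

⊆∧∣∣≤⇒⊇ : ∀ {S T} → T ⊆ₑ S → ∣ S ∣ₑ ≤ ∣ T ∣ₑ → S ⊆ₑ T
⊆∧∣∣≤⇒⊇ {S} {T} T⊆S ∣S∣≤∣T∣ e e∈S = decidable-stable (T e Bool.≟ true) λ e∉T →
  <⇒≱ (∈ₑ⇒1≤∣∣ {S ∖ₑ T} (∖⁺ {S = S} {T} e∈S e∉T)) (+-cancelˡ-≤ ∣ T ∣ₑ ∣ S ∖ₑ T ∣ₑ 0 (begin
    ∣ T ∣ₑ + ∣ S ∖ₑ T ∣ₑ   ≡⟨ ∣T∣+∣S∖T∣≡∣S∣ T⊆S ⟩
    ∣ S ∣ₑ                 ≤⟨ ∣S∣≤∣T∣ ⟩
    ∣ T ∣ₑ                 ≡⟨ +-identityʳ ∣ T ∣ₑ ⟨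
    ∣ T ∣ₑ + 0             ∎))
  where open ≤-Reasoning

∣∣≤2-of-Bool-injection : ∀ {S} (f : Edge → Bool) →
  (∀ e e' → e ∈ₑ S → e' ∈ₑ S → f e ≡ f e' → e ≡ e') → ∣ S ∣ₑ ≤ 2
∣∣≤2-of-Bool-injection {S} f f-injective = begin
  ∣ S ∣ₑ                      ≡⟨ countList-∩-∖ allEdges S f ⟨
  ∣ S ∩ₑ f ∣ₑ + ∣ S ∖ₑ f ∣ₑ   ≤⟨ +-mono-≤ (countList-≤1 allEdges-unique on-true)
                                            (countList-≤1 allEdges-unique on-false) ⟩
  2                           ∎
  where
  open ≤-Reasoning
  on-true : ∀ e e' → e ∈ₑ (S ∩ₑ f) → e' ∈ₑ (S ∩ₑ f) → e ≡ e'
  on-true e e' e∈ e'∈ = f-injective e e' (∩⁻ˡ {S = S} {f} e∈) (∩⁻ˡ {S = S} {f} e'∈)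
    (trans (∩⁻ʳ {S = S} {f} e∈) (sym (∩⁻ʳ {S = S} {f} e'∈)))
  on-false : ∀ e e' → e ∈ₑ (S ∖ₑ f) → e' ∈ₑ (S ∖ₑ f) → e ≡ e'
  on-false e e' e∈ e'∈ = f-injective e e' (∖⁻ˡ {S = S} {f} e∈) (∖⁻ˡ {S = S} {f} e'∈)
    (trans (∖⁻ʳ {S = S} {f} e∈) (sym (∖⁻ʳ {S = S} {f} e'∈)))

-- Finite sums and pigeonholes

≤-sum : ∀ {n} (c : Fin (suc n) → ℕ) k → c k ≤ sum c
≤-sum c k = ≤-trans (m≤m+n (c k) _) (≤-reflexive (sym (sum-remove {i = k} c)))

sum-removeAt≤ : ∀ {n} (c : Fin (suc n) → ℕ) k → sum (removeAt c k) ≤ sum c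
sum-removeAt≤ c k = ≤-trans (m≤n+m _ (c k)) (≤-reflexive (sym (sum-remove {i = k} c)))

*≤sum : ∀ {n} b (c : Fin n → ℕ) → (∀ k → b ≤ c k) → n * b ≤ sum c
*≤sum {zero} b c _ = z≤n
*≤sum {suc n} b c b≤c = +-mono-≤ (b≤c zero) (*≤sum b (c ∘ suc) (b≤c ∘ suc))

pigeonhole : ∀ {n} k (c : Fin n → ℕ) → sum c < n * suc k → ∃[ j ] c j ≤ k
pigeonhole {n} k c sum< with Fin.¬∀⟶∃¬ n (λ j → k < c j) (λ j → k <? c j) not-all-big
  where
  not-all-big : ¬ (∀ j → k < c j)
  not-all-big all-big = <⇒≱ sum< (*≤sum (suc k) c all-big)
... | j , c≯k = j , ≮⇒≥ c≯k

pigeonhole₂ : ∀ {n} k (c : Fin (suc n) → ℕ) → sum c < n * suc k →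
  ∃₂ λ p q → p ≢ q × c p ≤ k × c q ≤ k
pigeonhole₂ {n} k c sum< with pigeonhole k c (<-≤-trans sum< (m≤n+m (n * suc k) (suc k)))
... | p , cp≤k with pigeonhole k (removeAt c p) (≤-<-trans (sum-removeAt≤ c p) sum<)
... | q , cq≤k = p , punchIn p q , (λ p≡q → Fin.punchInᵢ≢i p q (sym p≡q)) , cp≤k , cq≤k

sum-disjoint≤ : ∀ {n} (P : Fin n → EdgeSet) {U} → (∀ k → P k ⊆ₑ U) →
  (∀ k l → k ≢ l → ∀ e → e ∈ₑ P k → ¬ e ∈ₑ P l) → sum (λ k → ∣ P k ∣ₑ) ≤ ∣ U ∣ₑ
sum-disjoint≤ {zero} _ _ _ = z≤n
sum-disjoint≤ {suc n} P {U} P⊆U disjoint = begin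
  ∣ P zero ∣ₑ + sum (λ k → ∣ P (suc k) ∣ₑ)
    ≤⟨ +-monoʳ-≤ ∣ P zero ∣ₑ (sum-disjoint≤ (P ∘ suc) rest⊆ rest-disjoint) ⟩
  ∣ P zero ∣ₑ + ∣ U ∖ₑ P zero ∣ₑ
    ≡⟨ ∣T∣+∣S∖T∣≡∣S∣ (P⊆U zero) ⟩
  ∣ U ∣ₑ ∎
  where
  open ≤-Reasoning
  rest⊆ : ∀ k → P (suc k) ⊆ₑ (U ∖ₑ P zero)
  rest⊆ k e e∈ = ∖⁺ {S = U} {P zero} (P⊆U (suc k) e e∈) (λ e∈P₀ → disjoint zero (suc k) (λ ()) e e∈P₀ e∈)
  rest-disjoint : ∀ k l → k ≢ l → ∀ e → e ∈ₑ P (suc k) → ¬ e ∈ₑ P (suc l)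
  rest-disjoint k l k≢l = disjoint (suc k) (suc l) (k≢l ∘ Fin.suc-injective)

6≤∣∪∣ : ∀ {A B} → ∣ A ∣ₑ ≡ 4 → ∣ B ∣ₑ ≡ 4 → ∣ A ∩ₑ B ∣ₑ ≤ 2 → 6 ≤ ∣ A ∪ₑ B ∣ₑ
6≤∣∪∣ {A} {B} ∣A∣≡4 ∣B∣≡4 ∣A∩B∣≤2 = +-cancelʳ-≤ 2 6 ∣ A ∪ₑ B ∣ₑ (begin
  8                           ≡⟨ cong₂ _+_ ∣A∣≡4 ∣B∣≡4 ⟨
  ∣ A ∣ₑ + ∣ B ∣ₑ             ≡⟨ countList-∪-∩ allEdges A B ⟨
  ∣ A ∪ₑ B ∣ₑ + ∣ A ∩ₑ B ∣ₑ   ≤⟨ +-monoʳ-≤ ∣ A ∪ₑ B ∣ₑ ∣A∩B∣≤2 ⟩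
  ∣ A ∪ₑ B ∣ₑ + 2             ∎)
  where open ≤-Reasoning

no-four-4-subsets-meeting-in-≤2 : ∀ {U} (A : Fin 4 → EdgeSet) → ∣ U ∣ₑ ≤ 6 → (∀ k → A k ⊆ₑ U) →
  (∀ k → ∣ A k ∣ₑ ≡ 4) → (∀ k l → k ≢ l → ∣ A k ∩ₑ A l ∣ₑ ≤ 2) → ⊥
no-four-4-subsets-meeting-in-≤2 {U} A ∣U∣≤6 A⊆U ∣A∣≡4 meet≤2 = <⇒≱ (m≤n⇒m≤1+n (s≤s ∣U∣≤6)) (begin
  4 * 2                        ≤⟨ *≤sum 2 (λ k → ∣ U ∖ₑ A k ∣ₑ) 2≤∣U∖A∣ ⟩
  sum (λ k → ∣ U ∖ₑ A k ∣ₑ)   ≤⟨ sum-disjoint≤ (λ k → U ∖ₑ A k) (λ k e → ∖⁻ˡ {S = U} {A k})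
                                   missed-at-most-once ⟩
  ∣ U ∣ₑ                       ∎)
  where
  open ≤-Reasoning
  ∪⊆U : ∀ k l → (A k ∪ₑ A l) ⊆ₑ U
  ∪⊆U k l = ∪-⊆ {A k} {A l} (A⊆U k) (A⊆U l)
  6≤∣∪∣′ : ∀ {k l} → k ≢ l → 6 ≤ ∣ A k ∪ₑ A l ∣ₑ
  6≤∣∪∣′ {k} {l} k≢l = 6≤∣∪∣ {A k} {A l} (∣A∣≡4 k) (∣A∣≡4 l) (meet≤2 k l k≢l)
  6≤∣U∣ : 6 ≤ ∣ U ∣ₑ
  6≤∣U∣ = ≤-trans (6≤∣∪∣′ {zero} {suc zero} (λ ()))
                  (∣∣-mono {A zero ∪ₑ A (suc zero)} {U} (∪⊆U zero (suc zero)))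
  2≤∣U∖A∣ : ∀ k → 2 ≤ ∣ U ∖ₑ A k ∣ₑ
  2≤∣U∖A∣ k = +-cancelˡ-≤ 4 2 ∣ U ∖ₑ A k ∣ₑ (begin
    6                          ≤⟨ 6≤∣U∣ ⟩
    ∣ U ∣ₑ                     ≡⟨ ∣T∣+∣S∖T∣≡∣S∣ {U} {A k} (A⊆U k) ⟨
    ∣ A k ∣ₑ + ∣ U ∖ₑ A k ∣ₑ   ≡⟨ cong (_+ ∣ U ∖ₑ A k ∣ₑ) (∣A∣≡4 k) ⟩
    4 + ∣ U ∖ₑ A k ∣ₑ          ∎)
  missed-at-most-once : ∀ k l → k ≢ l → ∀ e → e ∈ₑ (U ∖ₑ A k) → ¬ e ∈ₑ (U ∖ₑ A l)
  missed-at-most-once k l k≢l e e∈U∖Aₖ e∈U∖Aₗ =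
    [ Bool.not-¬ (∖⁻ʳ {S = U} {A k} e∈U∖Aₖ) , Bool.not-¬ (∖⁻ʳ {S = U} {A l} e∈U∖Aₗ) ]′
      (∪⁻ {e} {A k} {A l} (U⊆Aₖ∪Aₗ e (∖⁻ˡ {S = U} {A k} e∈U∖Aₖ)))
    where
    U⊆Aₖ∪Aₗ : U ⊆ₑ (A k ∪ₑ A l)
    U⊆Aₖ∪Aₗ = ⊆∧∣∣≤⇒⊇ {U} {A k ∪ₑ A l} (∪⊆U k l) (≤-trans ∣U∣≤6 (6≤∣∪∣′ k≢l))

hamming≡0 : ∀ {n} (x y : Vec Bool n) → (∀ t → lookup x t ≡ lookup y t) → hamming x y ≡ 0
hamming≡0 [] [] _ = refl
hamming≡0 (false ∷ x) (false ∷ y) agree = hamming≡0 x y (agree ∘ suc)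
hamming≡0 (true ∷ x) (true ∷ y) agree = hamming≡0 x y (agree ∘ suc)
hamming≡0 (false ∷ _) (true ∷ _) agree with () ← agree zero
hamming≡0 (true ∷ _) (false ∷ _) agree with () ← agree zero

hamming≤1 : ∀ {n} (x y : Vec Bool n) l → (∀ t → t ≢ l → lookup x t ≡ lookup y t) → hamming x y ≤ 1
hamming≤1 (a ∷ x) (b ∷ y) zero agree =
  +-mono-≤ (bit-distance≤1 a b) (≤-reflexive (hamming≡0 x y λ t → agree (suc t) λ ()))
  where
  bit-distance≤1 : ∀ a b → (if a then (if b then 0 else 1) else (if b then 1 else 0)) ≤ 1
  bit-distance≤1 false false = z≤n
  bit-distance≤1 false true = ≤-refl
  bit-distance≤1 true false = ≤-refl
  bit-distance≤1 true true = z≤n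
hamming≤1 (false ∷ x) (false ∷ y) (suc l) agree =
  hamming≤1 x y l λ t t≢l → agree (suc t) (t≢l ∘ Fin.suc-injective)
hamming≤1 (true ∷ x) (true ∷ y) (suc l) agree =
  hamming≤1 x y l λ t t≢l → agree (suc t) (t≢l ∘ Fin.suc-injective)
hamming≤1 (false ∷ _) (true ∷ _) (suc l) agree with () ← agree zero (λ ())
hamming≤1 (true ∷ _) (false ∷ _) (suc l) agree with () ← agree zero (λ ())

-- Opaque, so that the decision procedure behind the proof never unfolds at use sites.
opaque
  remaining-two : ∀ (i j k : Fin 5) → i ≢ j → i ≢ k → j ≢ k →
    ∃₂ λ s l → ∀ t → t ≡ i ⊎ t ≡ j ⊎ t ≡ k ⊎ t ≡ s ⊎ t ≡ l
  remaining-two = toWitness {a? =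
    Fin.all? λ i → Fin.all? λ j → Fin.all? λ k →
      ¬? (i Fin.≟ j) →-dec ¬? (i Fin.≟ k) →-dec ¬? (j Fin.≟ k) →-dec
      Fin.any? λ s → Fin.any? λ l → Fin.all? λ t →
        (t Fin.≟ i) ⊎-dec (t Fin.≟ j) ⊎-dec (t Fin.≟ k) ⊎-dec (t Fin.≟ s) ⊎-dec (t Fin.≟ l)} _

Fixes : Fin 5 → Bool → EdgeSet → Set
Fixes j δ A = ∀ e → e ∈ₑ A → lookup (lo e) j ≡ δ

Spread : EdgeSet → Set
Spread A = ∀ e e' → e ∈ₑ A → e' ∈ₑ A → e ≢ e' → hamming (lo e) (lo e') ≡ 2

lo-at-direction : ∀ {i} e → e ∈ₑ Edir i → lookup (lo e) i ≡ false
lo-at-direction {i} (i' , r) e∈Eᵢ with i' Fin.≟ i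
... | yes refl = Vec.insertAt-lookup r i' false

overlap≤2 : ∀ {i j k δ δ' A B} → i ≢ j → i ≢ k → j ≢ k → A ⊆ₑ Edir i → B ⊆ₑ Edir i →
  Fixes j δ A → Fixes k δ' B → Spread A → ∣ A ∩ₑ B ∣ₑ ≤ 2
overlap≤2 {i} {j} {k} {A = A} {B} i≢j i≢k j≢k A⊆Eᵢ B⊆Eᵢ A-fixes B-fixes A-spread
  with remaining-two i j k i≢j i≢k j≢k
... | s , l , enumerate = ∣∣≤2-of-Bool-injection {A ∩ₑ B} (λ e → lookup (lo e) s) determined
  where
  determined : ∀ e e' → e ∈ₑ (A ∩ₑ B) → e' ∈ₑ (A ∩ₑ B) → lookup (lo e) s ≡ lookup (lo e') s → e ≡ e'
  determined e e' e∈ e'∈ same-s = decidable-stable (e ≟ₑ e') λ e≢e' →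
    <⇒≱ (s≤s ≤-refl) (≤-trans (≤-reflexive (sym (A-spread e e' e∈A e'∈A e≢e')))
                              (hamming≤1 (lo e) (lo e') l agree))
    where
    e∈A = ∩⁻ˡ {S = A} {B} e∈
    e'∈A = ∩⁻ˡ {S = A} {B} e'∈
    e∈B = ∩⁻ʳ {S = A} {B} e∈
    e'∈B = ∩⁻ʳ {S = A} {B} e'∈
    agree : ∀ t → t ≢ l → lookup (lo e) t ≡ lookup (lo e') t
    agree t t≢l with enumerate t
    ... | inj₁ refl = trans (lo-at-direction e (A⊆Eᵢ e e∈A)) (sym (lo-at-direction e' (A⊆Eᵢ e' e'∈A)))
    ... | inj₂ (inj₁ refl) = trans (A-fixes e e∈A) (sym (A-fixes e' e'∈A))
    ... | inj₂ (inj₂ (inj₁ refl)) = trans (B-fixes e e∈B) (sym (B-fixes e' e'∈B))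
    ... | inj₂ (inj₂ (inj₂ (inj₁ refl))) = same-s
    ... | inj₂ (inj₂ (inj₂ (inj₂ refl))) = ⊥-elim (t≢l refl)

-- Exceptional triples

-- The M_δ of an exceptional triple for the split along j, with its dimension i.
record Quadruple (M : EdgeSet) (i j : Fin 5) : Set where
  field
    edges : EdgeSet
    δ : Bool
    size : ∣ edges ∣ₑ ≡ 4
    ⊆M : edges ⊆ₑ (Edir i ∩ₑ M)
    fixes : Fixes j δ edges
    spread : Spread edges
    i≢j : i ≢ j

open Quadruple using (edges; size; ⊆M)

quadruples-overlap≤2 : ∀ {M i j k} (Q : Quadruple M i j) (R : Quadruple M i k) → j ≢ k →
  ∣ edges Q ∩ₑ edges R ∣ₑ ≤ 2
quadruples-overlap≤2 {M} {i} Q R j≢k =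
  overlap≤2 (Quadruple.i≢j Q) (Quadruple.i≢j R) j≢k (⊆Eᵢ Q) (⊆Eᵢ R)
    (Quadruple.fixes Q) (Quadruple.fixes R) (Quadruple.spread Q)
  where
  ⊆Eᵢ : ∀ {j} (Q : Quadruple M i j) → edges Q ⊆ₑ Edir i
  ⊆Eᵢ Q e e∈ = ∩⁻ˡ {S = Edir i} {M} (⊆M Q e e∈)

Esub-fixes : ∀ j δ S → Fixes j δ (S ∩ₑ Esub j δ)
Esub-fixes j δ S e e∈ = if≡true (Bool.∧-conicalʳ _ _ (∩⁻ʳ {S = S} {Esub j δ} e∈))
  where
  if≡true : ∀ {a δ} → (if a then δ else not δ) ≡ true → a ≡ δ
  if≡true {true} {true} _ = refl
  if≡true {false} {false} _ = refl

exceptional-structure : ∀ {j δ M F} → Exceptional j δ M F →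
  ∃[ i ] (Quadruple M i j × 1 ≤ ∣ Edir i ∩ₑ F ∣ₑ)
exceptional-structure {j} {δ} {M} {F} (∣Mδ∣≡4 , ∣Fδ∣≡1 , i , i≢j , Mδ∪Fδ⊆Eᵢ , Mδ-spread) =
  i , quadruple , ≤-trans (≤-reflexive (sym ∣Fδ∣≡1)) (∣∣-mono {Fδ} {Edir i ∩ₑ F} Fδ⊆)
  where
  Mδ = M ∩ₑ Esub j δ
  Fδ = F ∩ₑ Esub j δ
  quadruple : Quadruple M i j
  quadruple = record
    { edges = Mδ
    ; δ = δ
    ; size = ∣Mδ∣≡4
    ; ⊆M = λ e e∈ → ∩⁺ {S = Edir i} {M} (Mδ∪Fδ⊆Eᵢ e (∪⁺ˡ {S = Mδ} {Fδ} e∈))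
                                        (∩⁻ˡ {S = M} {Esub j δ} e∈)
    ; fixes = Esub-fixes j δ M
    ; spread = Mδ-spread
    ; i≢j = i≢j
    }
  Fδ⊆ : Fδ ⊆ₑ (Edir i ∩ₑ F)
  Fδ⊆ e e∈ = ∩⁺ {S = Edir i} {F} (Mδ∪Fδ⊆Eᵢ e (∪⁺ʳ {S = Mδ} {Fδ} e∈)) (∩⁻ˡ {S = F} {Esub j δ} e∈)

exceptional? : ∀ j δ M F → Dec (Exceptional j δ M F)
exceptional? j δ M F =
  (∣ Mδ ∣ₑ ≟ 4) ×-dec (∣ Fδ ∣ₑ ≟ 1) ×-dec Fin.any? λ i →
    ¬? (i Fin.≟ j) ×-dec
    ∀-edges? (λ e → (e ∈ₑ? (Mδ ∪ₑ Fδ)) →-dec (e ∈ₑ? Edir i)) ×-dec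
    ∀-edges? λ e → ∀-edges? λ e' →
      (e ∈ₑ? Mδ) →-dec (e' ∈ₑ? Mδ) →-dec ¬? (e ≟ₑ e') →-dec (hamming (lo e) (lo e') ≟ 2)
  where
  Mδ = M ∩ₑ Esub j δ
  Fδ = F ∩ₑ Esub j δ
  _∈ₑ?_ : ∀ e S → Dec (e ∈ₑ S)
  e ∈ₑ? S = S e Bool.≟ true

exceptional-side : ∀ {j M F} → ¬ (∀ δ → ¬ Exceptional j δ M F) → ∃[ δ ] Exceptional j δ M F
exceptional-side {j} {M} {F} ¬∀δ = pick (exceptional? j false M F) (exceptional? j true M F)
  where
  pick : Dec (Exceptional j false M F) → Dec (Exceptional j true M F) → ∃[ δ ] Exceptional j δ M F
  pick (yes E) _ = false , E
  pick (no _) (yes E) = true , E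
  pick (no ¬E₀) (no ¬E₁) = ⊥-elim (¬∀δ λ { false → ¬E₀ ; true → ¬E₁ })

∀-Bool? : {P : Bool → Set} → (∀ b → Dec (P b)) → Dec (∀ b → P b)
∀-Bool? P? = map′ (λ (p₀ , p₁) → λ { false → p₀ ; true → p₁ }) (λ ∀P → ∀P false , ∀P true)
  (P? false ×-dec P? true)



budget : ∀ {m f} → ⌈ m /2⌉ ≤ 4 → f ≤ 4 ∸ ⌈ m /2⌉ → m + f ≤ ⌊ m /2⌋ + 4
budget {m} {f} ⌈m/2⌉≤4 f≤ = begin
  m + f                                  ≤⟨ +-monoʳ-≤ m f≤ ⟩
  m + (4 ∸ ⌈ m /2⌉)                      ≡⟨ cong (_+ (4 ∸ ⌈ m /2⌉)) (⌊n/2⌋+⌈n/2⌉≡n m) ⟨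
  ⌊ m /2⌋ + ⌈ m /2⌉ + (4 ∸ ⌈ m /2⌉)      ≡⟨ +-assoc ⌊ m /2⌋ ⌈ m /2⌉ (4 ∸ ⌈ m /2⌉) ⟩
  ⌊ m /2⌋ + (⌈ m /2⌉ + (4 ∸ ⌈ m /2⌉))    ≡⟨ cong (⌊ m /2⌋ +_) (m+[n∸m]≡n ⌈m/2⌉≤4) ⟩
  ⌊ m /2⌋ + 4                            ∎
  where open ≤-Reasoning

budget≤8 : ∀ {m f} → m ≤ 8 → f ≤ 4 ∸ ⌈ m /2⌉ → m + f ≤ 8
budget≤8 m≤8 f≤ = ≤-trans (budget (⌈n/2⌉-mono m≤8) f≤) (+-monoˡ-≤ 4 (⌊n/2⌋-mono m≤8))

budget≤7 : ∀ {m f} → 1 ≤ f → f ≤ 4 ∸ ⌈ m /2⌉ → m + f ≤ 7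
budget≤7 {m} {f} 1≤f f≤ =
  ≤-trans (budget (m≤n⇒m≤1+n ⌈m/2⌉≤3) f≤) (+-monoˡ-≤ 4 (≤-trans (⌊n/2⌋≤⌈n/2⌉ m) ⌈m/2⌉≤3))
  where
  ⌈m/2⌉≤3 : ⌈ m /2⌉ ≤ 3
  ⌈m/2⌉≤3 = s≤s⁻¹ (m∸n≢0⇒n<m λ 4∸⌈m/2⌉≡0 → <⇒≱ 1≤f (subst (f ≤_) 4∸⌈m/2⌉≡0 f≤))

-- Loads of the directions

module _ (M F : EdgeSet) (M∩F=∅ : ∀ e → e ∈ₑ M → F e ≡ false) where

  load : Fin 5 → ℕ
  load j = ∣ Edir j ∩ₑ (M ∪ₑ F) ∣ₑ

  load-split : ∀ j → load j ≡ ∣ Edir j ∩ₑ M ∣ₑ + ∣ Edir j ∩ₑ F ∣ₑ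
  load-split j = trans (countList-cong allEdges λ e → Bool.∧-distribˡ-∨ (Edir j e) (M e) (F e))
    (∣∪∣-disjoint {Edir j ∩ₑ M} {Edir j ∩ₑ F} disjoint)
    where
    disjoint : ∀ e → e ∈ₑ (Edir j ∩ₑ M) → ¬ e ∈ₑ (Edir j ∩ₑ F)
    disjoint e e∈M = Bool.not-¬ (M∩F=∅ e (∩⁻ʳ {S = Edir j} {M} e∈M)) ∘ ∩⁻ʳ {S = Edir j} {F}

  sum-load≤ : sum load ≤ ∣ M ∣ₑ + ∣ F ∣ₑ
  sum-load≤ = ≤-trans (≤-reflexive (sym (countList-by-direction allEdges (M ∪ₑ F)))) (∣∪∣≤ M F)

  quadruple-load≥5 : ∀ {i j} → Quadruple M i j → 1 ≤ ∣ Edir i ∩ₑ F ∣ₑ → 5 ≤ load i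
  quadruple-load≥5 {i} Q 1≤Fᵢ = begin
    4 + 1                                   ≤⟨ +-mono-≤ 4≤Mᵢ 1≤Fᵢ ⟩
    ∣ Edir i ∩ₑ M ∣ₑ + ∣ Edir i ∩ₑ F ∣ₑ    ≡⟨ load-split i ⟨
    load i                                  ∎
    where
    open ≤-Reasoning
    4≤Mᵢ = ≤-trans (≤-reflexive (sym (size Q))) (∣∣-mono {edges Q} {Edir i ∩ₑ M} (⊆M Q))

  light-quadruple : (∀ j → load j ≤ 1 → ∃[ δ ] Exceptional j δ M F) →
    ∀ {j} → load j ≤ 1 → ∃[ i ] (Quadruple M i j × 1 ≤ ∣ Edir i ∩ₑ F ∣ₑ)
  light-quadruple light⇒exceptional {j} light =
    exceptional-structure {j} {proj₁ exceptional} {M} {F} (proj₂ exceptional)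
    where
    exceptional = light⇒exceptional j light

  module HeavyDirection
    (light⇒exceptional : ∀ j → load j ≤ 1 → ∃[ δ ] Exceptional j δ M F)
    (total≤7 : ∣ M ∣ₑ + ∣ F ∣ₑ ≤ 7)
    (i : Fin 5) (1≤Fᵢ : 1 ≤ ∣ Edir i ∩ₑ F ∣ₑ) (5≤loadᵢ : 5 ≤ load i)
    where

    others : Fin 4 → ℕ
    others = removeAt load i

    loadᵢ+others≤7 : load i + sum others ≤ 7
    loadᵢ+others≤7 = ≤-trans (≤-reflexive (sym (sum-remove {i = i} load))) (≤-trans sum-load≤ total≤7)

    heavy-unique : ∀ {i'} → 5 ≤ load i' → i' ≡ i
    heavy-unique {i'} 5≤loadᵢ' = decidable-stable (i' Fin.≟ i) λ i'≢i → <⇒≱ 7<10 (begin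
      5 + 5                ≤⟨ +-mono-≤ 5≤loadᵢ 5≤loadᵢ' ⟩
      load i + load i'     ≤⟨ +-monoʳ-≤ (load i) (loadᵢ'≤others (i'≢i ∘ sym)) ⟩
      load i + sum others  ≤⟨ loadᵢ+others≤7 ⟩
      7                    ∎)
      where
      open ≤-Reasoning
      7<10 : 7 < 10
      7<10 = m≤m+n 8 2
      loadᵢ'≤others : i ≢ i' → load i' ≤ sum others
      loadᵢ'≤others i≢i' = subst (_≤ sum others) (cong load (Fin.punchIn-punchOut i≢i'))
        (≤-sum others (punchOut i≢i'))

    quadruple : ∀ {j} → load j ≤ 1 → Quadruple M i j
    quadruple {j} light = aligned (light-quadruple light⇒exceptional light)
      where
      aligned : ∃[ i' ] (Quadruple M i' j × 1 ≤ ∣ Edir i' ∩ₑ F ∣ₑ) → Quadruple M i j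
      aligned (i' , Q , 1≤Fᵢ') = subst (λ i' → Quadruple M i' j) (heavy-unique (quadruple-load≥5 Q 1≤Fᵢ')) Q

    others-overlap≤2 : ∀ {k l} (Q : Quadruple M i (punchIn i k)) (R : Quadruple M i (punchIn i l)) → k ≢ l →
      ∣ edges Q ∩ₑ edges R ∣ₑ ≤ 2
    others-overlap≤2 {k} {l} Q R k≢l = quadruples-overlap≤2 Q R (k≢l ∘ Fin.punchIn-injective i k l)

    Mᵢ : EdgeSet
    Mᵢ = Edir i ∩ₑ M

    ∣Mᵢ∣≤6 : ∣ Mᵢ ∣ₑ ≤ 6
    ∣Mᵢ∣≤6 = ≤-trans (∣∣-mono {Mᵢ} {M} (λ e → ∩⁻ʳ {S = Edir i} {M}))
      (+-cancelʳ-≤ 1 ∣ M ∣ₑ 6 (≤-trans (+-monoʳ-≤ ∣ M ∣ₑ 1≤F) total≤7))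
      where
      1≤F : 1 ≤ ∣ F ∣ₑ
      1≤F = ≤-trans 1≤Fᵢ (∣∣-mono {Edir i ∩ₑ F} {F} (λ e → ∩⁻ʳ {S = Edir i} {F}))

    sum-others≤2 : sum others ≤ 2
    sum-others≤2 = +-cancelˡ-≤ 5 (sum others) 2 (≤-trans (+-monoˡ-≤ (sum others) 5≤loadᵢ) loadᵢ+others≤7)

    6≤∣Mᵢ∣ : 6 ≤ ∣ Mᵢ ∣ₑ
    6≤∣Mᵢ∣ = two-light (pigeonhole₂ 1 others (≤-<-trans sum-others≤2 (s<s (s<s z<s))))
      where
      two-light : (∃₂ λ p q → p ≢ q × others p ≤ 1 × others q ≤ 1) → 6 ≤ ∣ Mᵢ ∣ₑ
      two-light (p , q , p≢q , light-p , light-q) =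
        ≤-trans (6≤∣∪∣ {edges Q} {edges R} (size Q) (size R) (others-overlap≤2 Q R p≢q))
          (∣∣-mono {edges Q ∪ₑ edges R} {Mᵢ} (∪-⊆ {edges Q} {edges R} (⊆M Q) (⊆M R)))
        where
        Q = quadruple light-p
        R = quadruple light-q

    all-others-light : ∀ k → others k ≤ 1
    all-others-light k = ≤-trans (≤-sum others k) (≤-trans sum-others≤0 z≤n)
      where
      7≤loadᵢ : 7 ≤ load i
      7≤loadᵢ = ≤-trans (+-mono-≤ 6≤∣Mᵢ∣ 1≤Fᵢ) (≤-reflexive (sym (load-split i)))
      sum-others≤0 : sum others ≤ 0
      sum-others≤0 = +-cancelˡ-≤ 7 (sum others) 0 (≤-trans (+-monoˡ-≤ (sum others) 7≤loadᵢ) loadᵢ+others≤7)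

    impossible : ⊥
    impossible = no-four-4-subsets-meeting-in-≤2 (edges ∘ Q) ∣Mᵢ∣≤6 (⊆M ∘ Q) (size ∘ Q)
      λ k l → others-overlap≤2 (Q k) (Q l)
      where
      Q : ∀ k → Quadruple M i (punchIn i k)
      Q k = quadruple (all-others-light k)

  ¬-all-light-exceptional : ∣ M ∣ₑ + ∣ F ∣ₑ ≤ 8 → (1 ≤ ∣ F ∣ₑ → ∣ M ∣ₑ + ∣ F ∣ₑ ≤ 7) →
    ¬ (∀ j → load j ≤ 1 → ∃[ δ ] Exceptional j δ M F)
  ¬-all-light-exceptional total≤8 total≤7 light⇒exceptional =
    heavy (light-quadruple light⇒exceptional (proj₂ some-light))
    where
    some-light = pigeonhole 1 load (s≤s (m≤n⇒m≤1+n (≤-trans sum-load≤ total≤8)))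
    heavy : ∃[ i ] (Quadruple M i (proj₁ some-light) × 1 ≤ ∣ Edir i ∩ₑ F ∣ₑ) → ⊥
    heavy (i , Q , 1≤Fᵢ) =
      HeavyDirection.impossible light⇒exceptional (total≤7 1≤F) i 1≤Fᵢ (quadruple-load≥5 Q 1≤Fᵢ)
      where
      1≤F : 1 ≤ ∣ F ∣ₑ
      1≤F = ≤-trans 1≤Fᵢ (∣∣-mono {Edir i ∩ₑ F} {F} (λ e → ∩⁻ʳ {S = Edir i} {F}))

lemma4p8 : (F M : EdgeSet) → IsMatchingOf M F →
    1 ≤ ∣ M ∣ₑ → ∣ M ∣ₑ ≤ 8 → ∣ F ∣ₑ ≤ 4 ∸ ⌈ ∣ M ∣ₑ /2⌉ →
    ∃[ j ] (∣ Edir j ∩ₑ (M ∪ₑ F) ∣ₑ ≤ 1 × (∀ (δ : Bool) → ¬ Exceptional j δ M F))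
lemma4p8 F M (M∩F=∅ , _) _ m≤8 f≤ = decidable-stable (Fin.any? good?) λ no-good-direction →
  ¬-all-light-exceptional M F M∩F=∅
    (budget≤8 {∣ M ∣ₑ} {∣ F ∣ₑ} m≤8 f≤) (λ 1≤f → budget≤7 {∣ M ∣ₑ} 1≤f f≤)
    λ j light → exceptional-side {j} {M} {F} λ unexceptional → no-good-direction (j , light , unexceptional)
  where
  good? : ∀ j → Dec (∣ Edir j ∩ₑ (M ∪ₑ F) ∣ₑ ≤ 1 × (∀ δ → ¬ Exceptional j δ M F))
  good? j = (∣ Edir j ∩ₑ (M ∪ₑ F) ∣ₑ ≤? 1) ×-dec ∀-Bool? (λ δ → ¬? (exceptional? j δ M F))
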